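{- Let $q$ be a prime power, $n\ge1$, $d=n+1$, and let $p_1(X),\dots,p_k(X)\in\mathbb{F}_q[X]$ be polynomials of degree $n$ with nonzero constant term, $p_i(X)=a^{(i)}_0+a^{(i)}_1X+\dots+a^{(i)}_nX^n$. Let $F_i:\mathbb{F}_q^{2n}\to\mathbb{F}_q^{n}$ be the no-boundary cellular automaton of length $2n$ with linear bipermutive local rule $f_i(x_0,\dots,x_n)=\sum_{j=0}^n a^{(i)}_jx_j$. Then the Latin squares $L_{F_1},\dots,L_{F_k}$ of order $q^n$ are mutually orthogonal if and only if $p_1,\dots,p_k$ are pairwise coprime; thus families of $k$ pairwise coprime such polynomials correspond to sets of $k$ mutually orthogonal Latin squares of order $q^n$ generated by linear bipermutive cellular automata.
   Context: For $m\ge d$, the no-boundary cellular automaton $F:A^m\to A^{m-d+1}$ with local rule $f:A^d\to A$ is $F(x_0,\dots,x_{m-1})=(f(x_0,\dots,x_{d-1}),\dots,f(x_{m-d},\dots,x_{m-1}))$. Fix a bijection $\phi:\mathbb{F}_q^{n}\to\{1,\dots,q^{n}\}$ with inverse $\psi$; the Latin square generated by $F:\mathbb{F}_q^{2n}\to\mathbb{F}_q^{n}$ is the $q^n\times q^n$ matrix $L_F(i,j)=\phi(F(\psi(i)\|\psi(j)))$, with $\|$ concatenation. Two Latin squares $L_1,L_2$ of order $N$ are orthogonal if the pairs $(L_1(i,j),L_2(i,j))$ are pairwise distinct over $(i,j)\in[N]^2$; a set of Latin squares is mutually orthogonal if its members are pairwise orthogonal. -}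

module Defs where

open import Level using (0ℓ)
open import Data.Nat as ℕ using (ℕ; zero; suc; _∸_; _^_; _≤_)
open import Data.Nat.Primality using (Prime)
open import Data.Nat.Properties using (+-mono-<-≤)
open import Data.Fin as Fin using (Fin; toℕ; fromℕ<)
open import Data.Fin.Properties using (toℕ<n; toℕ≤pred[n])
open import Data.Vec as Vec using (Vec; lookup; tabulate; _++_)
import Data.Vec.Functional as VF
open import Data.List using (List; []; _∷_)
open import Data.Product using (Σ; ∃; ∃-syntax; _×_; _,_)
open import Relation.Binary.PropositionalEquality using (_≡_; _≢_)
open import Algebra.Structures using (IsCommutativeRing)
open import Function.Bundles using (_⤖_; _↔_; Inverse)

IsPrimePower : ℕ → Set
IsPrimePower q = ∃[ p ] ∃[ k ] (Prime p × 1 ≤ k × q ≡ p ^ k)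

record Field : Set₁ where
  infixl 7 _*_
  infixl 6 _+_
  field
    Carrier : Set
    _+_ _*_ : Carrier → Carrier → Carrier
    -_      : Carrier → Carrier
    0# 1#   : Carrier
    isCommutativeRing : IsCommutativeRing _≡_ _+_ _*_ -_ 0# 1#
    0≢1     : 0# ≢ 1#
    inverse : ∀ x → x ≢ 0# → ∃[ y ] (x * y ≡ 1#)

HasOrder : Field → ℕ → Set
HasOrder K q = Field.Carrier K ⤖ Fin q

-- Polynomials over a field, as coefficient lists (lowest degree first),
-- compared coefficientwise (so trailing zeros are irrelevant).

module Poly (K : Field) where
  open Field K

  Pol : Set
  Pol = List Carrier

  coeff : Pol → ℕ → Carrier
  coeff []       _       = 0#
  coeff (a ∷ as) zero    = a
  coeff (a ∷ as) (suc m) = coeff as m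

  convSum : (ℕ → ℕ → Carrier) → ℕ → ℕ → Carrier
  convSum c m zero    = c 0 m
  convSum c m (suc i) = convSum c m i + c (suc i) (m ∸ suc i)

  mulCoeff : Pol → Pol → ℕ → Carrier
  mulCoeff p r m = convSum (λ i j → coeff p i * coeff r j) m m

  _∣ₚ_ : Pol → Pol → Set
  d ∣ₚ p = ∃[ r ] (∀ m → mulCoeff d r m ≡ coeff p m)

  Coprime : Pol → Pol → Set
  Coprime p r = ∀ d → d ∣ₚ p → d ∣ₚ r → d ∣ₚ (1# ∷ [])

-- No-boundary cellular automata.  Local rule of diameter d = suc e;
-- input length m = k + e (so m ≥ d iff k ≥ 1), output length
-- k = m - d + 1.

module CA {A : Set} where

  NBCA : (e k : ℕ) → ((Fin (suc e) → A) → A) → Vec A (k ℕ.+ e) → Vec A k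
  NBCA e k f x = tabulate λ i → f λ j →
    lookup x (fromℕ< (+-mono-<-≤ (toℕ<n i) (toℕ≤pred[n] j)))

-- Latin squares generated by F : A^{2n} → A^n, via a bijection
-- φ : A^n → Fin N (here N = q^n), ψ = φ⁻¹.

LatinSquareOf : {A : Set} {n N : ℕ} → (Vec A n ↔ Fin N) →
                (Vec A (n ℕ.+ n) → Vec A n) → Fin N → Fin N → Fin N
LatinSquareOf {n = n} φ F i j =
  Inverse.to φ (F (Inverse.from φ i ++ Inverse.from φ j))

Orthogonal : {N : ℕ} → (L₁ L₂ : Fin N → Fin N → Fin N) → Set
Orthogonal L₁ L₂ = ∀ i j i′ j′ → L₁ i j ≡ L₁ i′ j′ → L₂ i j ≡ L₂ i′ j′ →
                   i ≡ i′ × j ≡ j′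

MutuallyOrthogonal : {N k : ℕ} → (Fin k → Fin N → Fin N → Fin N) → Set
MutuallyOrthogonal L = ∀ a b → a ≢ b → Orthogonal (L a) (L b)

module Linear (K : Field) where
  open Field K

  linearRule : {d : ℕ} → (Fin d → Carrier) → (Fin d → Carrier) → Carrier
  linearRule a x = VF.foldr _+_ 0# (λ j → a j * x j)

  polyOf : {d : ℕ} → (Fin d → Carrier) → List Carrier
  polyOf a = Vec.toList (tabulate a)

module Submission where

-- The Latin squares L_F, L_G are orthogonal iff x ↦ (F x, G x) is injective on K^{2n}.
-- For linear rules, reading x ∈ K^{2n} as a sequence, F_p x = 0 says that x satisfies the
-- recurrence with characteristic polynomial p on its first n windows. If p and r are coprime,
-- a common kernel vector extends to a sequence annihilated, as a shift operator, by both p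
-- and r; the annihilator is an ideal of K[X], so Euclid's algorithm shows that 1 annihilates
-- the sequence too, which is then zero. Conversely, a nonconstant common factor d has a
-- nonzero recurrent sequence, and the multiples p and r of d annihilate it as well.

open import Defs
open import Level using (0ℓ)
open import Algebra.Bundles using (CommutativeRing)
open import Data.Nat using (ℕ; zero; suc; _+_; _∸_; _^_; _≤_; _<_; _<?_; _≤?_; z≤n; s≤s)
import Data.Nat.Properties as ℕ
open import Data.Fin using (Fin; zero; fromℕ)
import Data.Fin as Fin
import Data.Fin.Properties as Fin
open import Data.Vec using (Vec; _∷_; _++_; lookup; tabulate; replicate)
import Data.Vec as Vec
import Data.Vec.Properties as Vec
open import Data.List using ([]; _∷_; length; applyUpTo)
import Data.Product
open import Data.Product using (Σ-syntax; _×_; _,_; proj₁; proj₂)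
open import Data.Sum using (_⊎_; inj₁; inj₂)
open import Data.Empty using (⊥-elim)
open import Function.Bundles using (_↔_; _⇔_; Inverse; Bijection; mk⇔)
open import Relation.Nullary using (yes; no)
open import Relation.Binary.Definitions using (DecidableEquality)
open import Relation.Binary.PropositionalEquality
  using (_≡_; _≢_; refl; sym; trans; cong; cong₂; subst; _≗_; module ≡-Reasoning)

lookup-ext : ∀ {A : Set} {m} (u v : Vec A m) → (∀ i → lookup u i ≡ lookup v i) → u ≡ v
lookup-ext u v u≡v = trans (sym (Vec.tabulate∘lookup u)) (trans (Vec.tabulate-cong u≡v) (Vec.tabulate∘lookup v))

JointlyInjective : {A : Set} {m k : ℕ} → (F G : Vec A m → Vec A k) → Set
JointlyInjective F G = ∀ u v → F u ≡ F v → G u ≡ G v → u ≡ v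

module _ {A : Set} {n N : ℕ} (φ : Vec A n ↔ Fin N) where
  open Inverse φ using (to; from; strictlyInverseˡ; strictlyInverseʳ)

  private
    to-injective : ∀ {x y} → to x ≡ to y → x ≡ y
    to-injective {x} {y} eq = trans (sym (strictlyInverseʳ x)) (trans (cong from eq) (strictlyInverseʳ y))

    from-injective : ∀ {i j} → from i ≡ from j → i ≡ j
    from-injective {i} {j} eq = trans (sym (strictlyInverseˡ i)) (trans (cong to eq) (strictlyInverseˡ j))

    square-at-to : ∀ F x y → LatinSquareOf φ F (to x) (to y) ≡ to (F (x ++ y))
    square-at-to F x y = cong (λ z → to (F z)) (cong₂ _++_ (strictlyInverseʳ x) (strictlyInverseʳ y))

  orthogonal⇒jointlyInjective : ∀ F G → Orthogonal (LatinSquareOf φ F) (LatinSquareOf φ G) → JointlyInjective F G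
  orthogonal⇒jointlyInjective F G orthogonal u v Fu≡Fv Gu≡Gv
    with u₁ , u₂ , refl ← Vec.splitAt n u | v₁ , v₂ , refl ← Vec.splitAt n v
    with to-u₁≡to-v₁ , to-u₂≡to-v₂ ← orthogonal (to u₁) (to u₂) (to v₁) (to v₂)
           (trans (square-at-to F u₁ u₂) (trans (cong to Fu≡Fv) (sym (square-at-to F v₁ v₂))))
           (trans (square-at-to G u₁ u₂) (trans (cong to Gu≡Gv) (sym (square-at-to G v₁ v₂))))
    = cong₂ _++_ (to-injective to-u₁≡to-v₁) (to-injective to-u₂≡to-v₂)

  jointlyInjective⇒orthogonal : ∀ F G → JointlyInjective F G → Orthogonal (LatinSquareOf φ F) (LatinSquareOf φ G)
  jointlyInjective⇒orthogonal F G injective i j i′ j′ Fij≡Fi′j′ Gij≡Gi′j′ =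
    Data.Product.map from-injective from-injective
      (Vec.++-injective (from i) (from i′) (injective _ _ (to-injective Fij≡Fi′j′) (to-injective Gij≡Gi′j′)))

module _ (K : Field) where
  open Field K renaming (_+_ to _⊕_; _*_ to _·_)

  commutativeRing : CommutativeRing 0ℓ 0ℓ
  commutativeRing = record
    { Carrier = Carrier ; _≈_ = _≡_ ; _+_ = _⊕_ ; _*_ = _·_ ; -_ = -_
    ; 0# = 0# ; 1# = 1# ; isCommutativeRing = isCommutativeRing }

  open CommutativeRing commutativeRing
    using (+-comm; +-identityˡ; +-identityʳ; -‿inverseʳ;
           *-assoc; *-comm; *-identityˡ; *-identityʳ; distribˡ; distribʳ;
           zeroˡ; zeroʳ; ring; +-abelianGroup; *-commutativeSemigroup; semiring)
  open import Algebra.Properties.Ring ring using (-‿distribˡ-*; -‿distribʳ-*)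
  open import Algebra.Properties.AbelianGroup +-abelianGroup
    using (inverseʳ-unique; x∙y⁻¹≈ε⇒x≈y; ε⁻¹≈ε; ⁻¹-∙-comm; //-rightDividesˡ)
  open import Algebra.Properties.CommutativeSemigroup *-commutativeSemigroup
    using (x∙yz≈y∙xz)
  open import Algebra.Properties.Semiring.Sum semiring
    using (sum; sum-cong-≗; sum-replicate-zero; sum-init-last; ∑-distrib-+; ∑-comm; *-distribˡ-sum)
  open import Algebra.Properties.CommutativeSemigroup ℕ.+-commutativeSemigroup
    using () renaming (xy∙z≈xz∙y to m+n+o≡m+o+n)
  open ≡-Reasoning

  *-cancel-inverse : ∀ {c c′} → c′ · c ≡ 1# → ∀ a → c′ · (c · a) ≡ a
  *-cancel-inverse {c} {c′} c′c≡1 a = trans (sym (*-assoc c′ c a)) (trans (cong (_· a) c′c≡1) (*-identityˡ a))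

  *-cancelˡ-≢0 : ∀ {c a b} → c ≢ 0# → c · a ≡ c · b → a ≡ b
  *-cancelˡ-≢0 {c} {a} {b} c≢0 ca≡cb with c⁻¹ , cc⁻¹≡1 ← inverse c c≢0 = begin
    a               ≡⟨ *-cancel-inverse c⁻¹c≡1 a ⟨
    c⁻¹ · (c · a)   ≡⟨ cong (c⁻¹ ·_) ca≡cb ⟩
    c⁻¹ · (c · b)   ≡⟨ *-cancel-inverse c⁻¹c≡1 b ⟩
    b               ∎
    where c⁻¹c≡1 = trans (*-comm c⁻¹ c) cc⁻¹≡1

  Seq : Set
  Seq = ℕ → Carrier

  ∑< : ℕ → Seq → Carrier
  ∑< B f = sum {B} (λ a → f (Fin.toℕ a))

  ∑<-cong : ∀ B {f g : Seq} → (∀ a → a < B → f a ≡ g a) → ∑< B f ≡ ∑< B g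
  ∑<-cong B f≡g = sum-cong-≗ (λ a → f≡g (Fin.toℕ a) (Fin.toℕ<n a))

  ∑<-zero : ∀ B {f : Seq} → (∀ a → a < B → f a ≡ 0#) → ∑< B f ≡ 0#
  ∑<-zero B f≡0 = trans (∑<-cong B f≡0) (sum-replicate-zero B)

  ∑<-+ : ∀ B (f g : Seq) → ∑< B (λ a → f a ⊕ g a) ≡ ∑< B f ⊕ ∑< B g
  ∑<-+ B f g = ∑-distrib-+ {B} (λ a → f (Fin.toℕ a)) (λ a → g (Fin.toℕ a))

  *-distribˡ-∑< : ∀ B c (f : Seq) → c · ∑< B f ≡ ∑< B (λ a → c · f a)
  *-distribˡ-∑< B c f = *-distribˡ-sum {B} c (λ a → f (Fin.toℕ a))

  -‿distrib-∑< : ∀ B (f : Seq) → - ∑< B f ≡ ∑< B (λ a → - f a)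
  -‿distrib-∑< zero    f = ε⁻¹≈ε
  -‿distrib-∑< (suc B) f = trans (sym (⁻¹-∙-comm (f 0) _)) (cong (- f 0 ⊕_) (-‿distrib-∑< B (λ a → f (suc a))))

  ∑<-comm : ∀ B C (f : ℕ → ℕ → Carrier) →
            ∑< B (λ a → ∑< C (λ b → f a b)) ≡ ∑< C (λ b → ∑< B (λ a → f a b))
  ∑<-comm B C f = ∑-comm {B} {C} (λ a b → f (Fin.toℕ a) (Fin.toℕ b))

  ∑<-last : ∀ B (f : Seq) → ∑< (suc B) f ≡ ∑< B f ⊕ f B
  ∑<-last B f = trans (sum-init-last {B} (λ a → f (Fin.toℕ a)))
    (cong₂ _⊕_ (sum-cong-≗ {B} (λ a → cong f (Fin.toℕ-inject₁ a))) (cong f (Fin.toℕ-fromℕ B)))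

  ∑<-pad : ∀ {B B′} (f : Seq) → (∀ a → B ≤ a → f a ≡ 0#) → B ≤ B′ → ∑< B′ f ≡ ∑< B f
  ∑<-pad {zero}  {B′}     f f≡0 _         = ∑<-zero B′ (λ a _ → f≡0 a z≤n)
  ∑<-pad {suc B} {suc B′} f f≡0 (s≤s B≤B′) =
    cong (f 0 ⊕_) (∑<-pad (λ a → f (suc a)) (λ a B≤a → f≡0 (suc a) (s≤s B≤a)) B≤B′)

  ZeroFrom : ℕ → Seq → Set
  ZeroFrom B s = ∀ m → B ≤ m → s m ≡ 0#

  zeroFrom-mono : ∀ {B B′ s} → B ≤ B′ → ZeroFrom B s → ZeroFrom B′ s
  zeroFrom-mono B≤B′ s≡0 m B′≤m = s≡0 m (ℕ.≤-trans B≤B′ B′≤m)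

  -- multiplication by X
  shift : Seq → Seq
  shift s zero    = 0#
  shift s (suc m) = s m

  zeroFrom-shift : ∀ {B s} → ZeroFrom B s → ZeroFrom (suc B) (shift s)
  zeroFrom-shift s≡0 (suc m) (s≤s B≤m) = s≡0 m B≤m

  shift-cong : ∀ {s t} → s ≗ t → shift s ≗ shift t
  shift-cong s≗t zero    = refl
  shift-cong s≗t (suc m) = s≗t m

  open Poly K using (Pol; coeff; mulCoeff; _∣ₚ_; Coprime)

  δ : Seq
  δ = coeff (1# ∷ [])

  _⋆_ : Seq → Seq → Seq
  (d ⋆ s) m = ∑< (suc m) (λ i → d i · s (m ∸ i))

  convSum≡∑< : ∀ (c : ℕ → ℕ → Carrier) m k → Poly.convSum K c m k ≡ ∑< (suc k) (λ i → c i (m ∸ i))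
  convSum≡∑< c m zero    = sym (+-identityʳ (c 0 m))
  convSum≡∑< c m (suc k) =
    trans (cong (_⊕ c (suc k) (m ∸ suc k)) (convSum≡∑< c m k)) (sym (∑<-last (suc k) (λ i → c i (m ∸ i))))

  mulCoeff≡⋆ : ∀ p r m → mulCoeff p r m ≡ (coeff p ⋆ coeff r) m
  mulCoeff≡⋆ p r m = convSum≡∑< (λ i j → coeff p i · coeff r j) m m

  ⋆-cong : ∀ {d d′ s s′} → d ≗ d′ → s ≗ s′ → d ⋆ s ≗ d′ ⋆ s′
  ⋆-cong d≗d′ s≗s′ m = ∑<-cong (suc m) (λ i _ → cong₂ _·_ (d≗d′ i) (s≗s′ (m ∸ i)))

  ⋆-zeroʳ : ∀ d {s} → (∀ j → s j ≡ 0#) → ∀ m → (d ⋆ s) m ≡ 0#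
  ⋆-zeroʳ d s≡0 m = ∑<-zero (suc m) (λ i _ → trans (cong (d i ·_) (s≡0 (m ∸ i))) (zeroʳ (d i)))

  ⋆-suc : ∀ d s m → (d ⋆ s) (suc m) ≡ (d ⋆ (λ j → s (suc j))) m ⊕ d (suc m) · s 0
  ⋆-suc d s m = trans (∑<-last (suc m) (λ i → d i · s (suc m ∸ i)))
    (cong₂ _⊕_ (∑<-cong (suc m) (λ i i≤m → cong (λ k → d i · s k) (ℕ.+-∸-assoc 1 (ℕ.≤-pred i≤m))))
               (cong (λ k → d (suc m) · s k) (ℕ.n∸n≡0 m)))

  ⋆-unfoldʳ : ∀ d s m → (d ⋆ s) m ≡ s 0 · d m ⊕ shift (d ⋆ (λ j → s (suc j))) m
  ⋆-unfoldʳ d s zero    = cong (_⊕ 0#) (*-comm (d 0) (s 0))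
  ⋆-unfoldʳ d s (suc m) = trans (⋆-suc d s m)
    (trans (+-comm _ (d (suc m) · s 0)) (cong (_⊕ (d ⋆ (λ j → s (suc j))) m) (*-comm (d (suc m)) (s 0))))

  ⋆-shift : ∀ d s m → (d ⋆ shift s) m ≡ shift (d ⋆ s) m
  ⋆-shift d s zero    = trans (+-identityʳ _) (zeroʳ (d 0))
  ⋆-shift d s (suc m) =
    trans (⋆-suc d (shift s) m) (trans (cong ((d ⋆ s) m ⊕_) (zeroʳ (d (suc m)))) (+-identityʳ _))

  ⋆-δ : ∀ d m → (d ⋆ δ) m ≡ d m
  ⋆-δ d zero    = trans (+-identityʳ _) (*-identityʳ (d 0))
  ⋆-δ d (suc m) = begin
    (d ⋆ δ) (suc m)                             ≡⟨ ⋆-suc d δ m ⟩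
    (d ⋆ (λ _ → 0#)) m ⊕ d (suc m) · 1#         ≡⟨ cong₂ _⊕_ (⋆-zeroʳ d (λ _ → refl) m) (*-identityʳ (d (suc m))) ⟩
    0# ⊕ d (suc m)                              ≡⟨ +-identityˡ (d (suc m)) ⟩
    d (suc m)                                   ∎

  ⋆-distribˡ-+ : ∀ d s t m → (d ⋆ (λ j → s j ⊕ t j)) m ≡ (d ⋆ s) m ⊕ (d ⋆ t) m
  ⋆-distribˡ-+ d s t m = trans (∑<-cong (suc m) (λ i _ → distribˡ (d i) (s (m ∸ i)) (t (m ∸ i))))
                                 (∑<-+ (suc m) (λ i → d i · s (m ∸ i)) (λ i → d i · t (m ∸ i)))

  ⋆-scaleʳ : ∀ d c s m → (d ⋆ (λ j → c · s j)) m ≡ c · (d ⋆ s) m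
  ⋆-scaleʳ d c s m = trans (∑<-cong (suc m) (λ i _ → x∙yz≈y∙xz (d i) c (s (m ∸ i))))
                               (sym (*-distribˡ-∑< (suc m) c (λ i → d i · s (m ∸ i))))

  record _∣_ (g a : Seq) : Set where
    constructor divides
    field
      quotient          : Seq
      quotient-bound    : ℕ
      quotient-zeroFrom : ZeroFrom quotient-bound quotient
      equation          : g ⋆ quotient ≗ a

  ∣-refl : ∀ g → g ∣ g
  ∣-refl g = divides δ 1 (λ { (suc m) _ → refl }) (⋆-δ g)

  ∣-zero : ∀ g {a} → (∀ m → a m ≡ 0#) → g ∣ a
  ∣-zero g a≡0 = divides (λ _ → 0#) 0 (λ _ _ → refl) (λ m → trans (⋆-zeroʳ g (λ _ → refl) m) (sym (a≡0 m)))

  ∣-cong : ∀ {g a b} → a ≗ b → g ∣ a → g ∣ b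
  ∣-cong a≗b (divides s B s≡0 g⋆s≗a) = divides s B s≡0 (λ m → trans (g⋆s≗a m) (a≗b m))

  ∣-+ : ∀ {g a b} → g ∣ a → g ∣ b → g ∣ (λ m → a m ⊕ b m)
  ∣-+ {g} (divides s B s≡0 g⋆s≗a) (divides t C t≡0 g⋆t≗b) =
    divides (λ j → s j ⊕ t j) (B + C)
      (λ m B+C≤m → trans (cong₂ _⊕_ (zeroFrom-mono (ℕ.m≤m+n B C) s≡0 m B+C≤m)
                                    (zeroFrom-mono (ℕ.m≤n+m C B) t≡0 m B+C≤m)) (+-identityʳ 0#))
      (λ m → trans (⋆-distribˡ-+ g s t m) (cong₂ _⊕_ (g⋆s≗a m) (g⋆t≗b m)))

  ∣-scale : ∀ {g a} c → g ∣ a → g ∣ (λ m → c · a m)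
  ∣-scale {g} c (divides s B s≡0 g⋆s≗a) =
    divides (λ j → c · s j) B (λ m B≤m → trans (cong (c ·_) (s≡0 m B≤m)) (zeroʳ c))
      (λ m → trans (⋆-scaleʳ g c s m) (cong (c ·_) (g⋆s≗a m)))

  ∣-shift : ∀ {g a} → g ∣ a → g ∣ shift a
  ∣-shift {g} (divides s B s≡0 g⋆s≗a) =
    divides (shift s) (suc B) (zeroFrom-shift s≡0) (λ m → trans (⋆-shift g s m) (shift-cong g⋆s≗a m))

  shift^ : ℕ → Seq → Seq
  shift^ zero    s = s
  shift^ (suc k) s = shift (shift^ k s)

  shift^-+ : ∀ k s j → shift^ k s (k + j) ≡ s j
  shift^-+ zero    s j = refl
  shift^-+ (suc k) s j = shift^-+ k s j

  zeroFrom-shift^ : ∀ k {B s} → ZeroFrom B s → ZeroFrom (k + B) (shift^ k s)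
  zeroFrom-shift^ zero    s≡0 = s≡0
  zeroFrom-shift^ (suc k) s≡0 = zeroFrom-shift (zeroFrom-shift^ k s≡0)

  ∣-shift^ : ∀ k {g a} → g ∣ a → g ∣ shift^ k a
  ∣-shift^ zero    g∣a = g∣a
  ∣-shift^ (suc k) g∣a = ∣-shift (∣-shift^ k g∣a)

  -- K[X]-submodules of K^ℕ, X acting by shift: on polynomials these are the ideals of K[X].
  record IsIdeal (P : Seq → Set) : Set where
    field
      ∈-cong       : ∀ {s t} → s ≗ t → P s → P t
      +-closed     : ∀ {s t} → P s → P t → P (λ m → s m ⊕ t m)
      scale-closed : ∀ {s} c → P s → P (λ m → c · s m)
      shift-closed : ∀ {s} → P s → P (shift s)

    shift^-closed : ∀ k {s} → P s → P (shift^ k s)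
    shift^-closed zero    Ps = Ps
    shift^-closed (suc k) Ps = shift-closed (shift^-closed k Ps)

    ⋆-closed : ∀ {d} → P d → ∀ B {s} → ZeroFrom B s → P (d ⋆ s)
    ⋆-closed {d} Pd zero {s} s≡0 =
      ∈-cong (λ m → trans (zeroˡ (d m)) (sym (⋆-zeroʳ d (λ j → s≡0 j z≤n) m))) (scale-closed 0# Pd)
    ⋆-closed {d} Pd (suc B) {s} s≡0 =
      ∈-cong (λ m → sym (⋆-unfoldʳ d s m))
        (+-closed (scale-closed (s 0) Pd) (shift-closed (⋆-closed Pd B (λ m B≤m → s≡0 (suc m) (s≤s B≤m)))))

  CommonDivisorIn : (Seq → Set) → Seq → Seq → Set
  CommonDivisorIn P a b = Σ[ g ∈ Seq ] Σ[ B ∈ ℕ ] ZeroFrom B g × P g × g ∣ a × g ∣ b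

  CommonDivisorIn-sym : ∀ {P a b} → CommonDivisorIn P a b → CommonDivisorIn P b a
  CommonDivisorIn-sym (g , B , g≡0 , Pg , g∣a , g∣b) = g , B , g≡0 , Pg , g∣b , g∣a

  -- One Euclidean step: for eb ≤ ea, the leading coefficient a_ea of a cancels against
  -- that of X^(ea ∸ eb) b.
  module Reduction (a b : Seq) (ea eb : ℕ) (eb≤ea : eb ≤ ea) where

    X^k·b : Seq
    X^k·b = shift^ (ea ∸ eb) b

    reduced : Seq
    reduced m = b eb · a m ⊕ (- a ea) · X^k·b m

    reduced-zeroFrom : ZeroFrom (suc ea) a → ZeroFrom (suc eb) b → ZeroFrom ea reduced
    reduced-zeroFrom a≡0 b≡0 m ea≤m with ℕ.m≤n⇒m<n∨m≡n ea≤m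
    ... | inj₁ ea<m = trans (cong₂ _⊕_ (trans (cong (b eb ·_) (a≡0 m ea<m)) (zeroʳ (b eb)))
                                      (trans (cong (- a ea ·_) (X^k·b≡0 m ea<m)) (zeroʳ (- a ea))))
                            (+-identityʳ 0#)
      where
      X^k·b≡0 : ZeroFrom (suc ea) X^k·b
      X^k·b≡0 = subst (λ B → ZeroFrom B X^k·b) (trans (ℕ.+-suc (ea ∸ eb) eb) (cong suc (ℕ.m∸n+n≡m eb≤ea)))
                      (zeroFrom-shift^ (ea ∸ eb) b≡0)
    ... | inj₂ refl = begin
      b eb · a ea ⊕ (- a ea) · X^k·b ea     ≡⟨ cong (λ t → b eb · a ea ⊕ (- a ea) · t) X^k·b-top ⟩
      b eb · a ea ⊕ (- a ea) · b eb         ≡⟨ cong (b eb · a ea ⊕_) (trans (*-comm (- a ea) (b eb)) (sym (-‿distribʳ-* (b eb) (a ea)))) ⟩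
      b eb · a ea ⊕ - (b eb · a ea)         ≡⟨ -‿inverseʳ (b eb · a ea) ⟩
      0#                                    ∎
      where
      X^k·b-top : X^k·b ea ≡ b eb
      X^k·b-top = trans (cong X^k·b (sym (ℕ.m∸n+n≡m eb≤ea))) (shift^-+ (ea ∸ eb) b eb)

    reduced-∈ : ∀ {P} → IsIdeal P → P a → P b → P reduced
    reduced-∈ ideal Pa Pb = +-closed (scale-closed (b eb) Pa) (scale-closed (- a ea) (shift^-closed (ea ∸ eb) Pb))
      where open IsIdeal ideal

    ∣-reduced⇒∣ : ∀ {g} → b eb ≢ 0# → g ∣ reduced → g ∣ b → g ∣ a
    ∣-reduced⇒∣ b-top≢0 g∣r g∣b with inverse (b eb) b-top≢0
    ... | b⁻¹ , bb⁻¹≡1 = ∣-cong a≗ (∣-scale b⁻¹ (∣-+ g∣r (∣-scale (a ea) (∣-shift^ (ea ∸ eb) g∣b))))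
      where
      a≗ : ∀ m → b⁻¹ · (reduced m ⊕ a ea · X^k·b m) ≡ a m
      a≗ m = begin
        b⁻¹ · ((b eb · a m ⊕ (- a ea) · X^k·b m) ⊕ a ea · X^k·b m)
          ≡⟨ cong (λ t → b⁻¹ · ((b eb · a m ⊕ t) ⊕ a ea · X^k·b m)) (sym (-‿distribˡ-* (a ea) (X^k·b m))) ⟩
        b⁻¹ · ((b eb · a m ⊕ - (a ea · X^k·b m)) ⊕ a ea · X^k·b m)
          ≡⟨ cong (b⁻¹ ·_) (//-rightDividesˡ (a ea · X^k·b m) (b eb · a m)) ⟩
        b⁻¹ · (b eb · a m)
          ≡⟨ *-cancel-inverse (trans (*-comm b⁻¹ (b eb)) bb⁻¹≡1) (a m) ⟩
        a m ∎

    reduce-step : ∀ {P} → IsIdeal P → b eb ≢ 0# → ZeroFrom (suc ea) a → ZeroFrom (suc eb) b → P a → P b →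
                  (ZeroFrom ea reduced → P reduced → CommonDivisorIn P reduced b) → CommonDivisorIn P a b
    reduce-step ideal b-top≢0 a≡0 b≡0 Pa Pb recurse
      with g , B , g≡0 , Pg , g∣r , g∣b ← recurse (reduced-zeroFrom a≡0 b≡0) (reduced-∈ ideal Pa Pb)
      = g , B , g≡0 , Pg , ∣-reduced⇒∣ b-top≢0 g∣r g∣b , g∣b

  zeroFrom-pred : ∀ {e s} → ZeroFrom (suc e) s → s e ≡ 0# → ZeroFrom e s
  zeroFrom-pred s≡0 s-e≡0 m e≤m with ℕ.m≤n⇒m<n∨m≡n e≤m
  ... | inj₁ e<m = s≡0 m e<m
  ... | inj₂ refl = s-e≡0

  degree? : DecidableEquality Carrier → ∀ B {s} → ZeroFrom B s →
            (∀ m → s m ≡ 0#) ⊎ (Σ[ e ∈ ℕ ] s e ≢ 0# × ZeroFrom (suc e) s)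
  degree? _≟_ zero    s≡0 = inj₁ (λ m → s≡0 m z≤n)
  degree? _≟_ (suc B) {s} s≡0 with s B ≟ 0#
  ... | yes s-B≡0 = degree? _≟_ B (zeroFrom-pred s≡0 s-B≡0)
  ... | no  s-B≢0 = inj₂ (B , s-B≢0 , s≡0)

  module _ (_≟_ : DecidableEquality Carrier) {P : Seq → Set} (ideal : IsIdeal P) where

    euclid : ∀ Na Nb {a b} → ZeroFrom Na a → ZeroFrom Nb b → P a → P b → CommonDivisorIn P a b
    euclid zero     Nb {a} {b} a≡0 b≡0 Pa Pb = b , Nb , b≡0 , Pb , ∣-zero b (λ m → a≡0 m z≤n) , ∣-refl b
    euclid (suc ea) zero {a} {b} a≡0 b≡0 Pa Pb = a , suc ea , a≡0 , Pa , ∣-refl a , ∣-zero a (λ m → b≡0 m z≤n)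
    euclid (suc ea) (suc eb) {a} {b} a≡0 b≡0 Pa Pb with a ea ≟ 0# | b eb ≟ 0# | eb ≤? ea
    ... | yes a-top≡0 | _ | _ = euclid ea (suc eb) (zeroFrom-pred a≡0 a-top≡0) b≡0 Pa Pb
    ... | no _ | yes b-top≡0 | _ = euclid (suc ea) eb a≡0 (zeroFrom-pred b≡0 b-top≡0) Pa Pb
    ... | no _ | no b-top≢0 | yes eb≤ea =
      Reduction.reduce-step a b ea eb eb≤ea ideal b-top≢0 a≡0 b≡0 Pa Pb
        (λ r≡0 Pr → euclid ea (suc eb) r≡0 b≡0 Pr Pb)
    ... | no a-top≢0 | no _ | no eb≰ea = CommonDivisorIn-sym (
      Reduction.reduce-step b a eb ea (ℕ.<⇒≤ (ℕ.≰⇒> eb≰ea)) ideal a-top≢0 b≡0 a≡0 Pb Pa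
        (λ r≡0 Pr → CommonDivisorIn-sym (euclid (suc ea) eb a≡0 r≡0 Pa Pr)))

  -- act B c y i = (c(σ) y) i for the shift σ of y, provided c vanishes from B on.
  act : ℕ → Seq → Seq → Seq
  act B c y i = ∑< B (λ a → c a · y (i + a))

  act-comm : ∀ B C c d y j → act B c (act C d y) j ≡ act C d (act B c y) j
  act-comm B C c d y j = begin
    ∑< B (λ a → c a · ∑< C (λ b → d b · y (j + a + b)))
      ≡⟨ ∑<-cong B (λ a _ → *-distribˡ-∑< C (c a) (λ b → d b · y (j + a + b))) ⟩
    ∑< B (λ a → ∑< C (λ b → c a · (d b · y (j + a + b))))
      ≡⟨ ∑<-comm B C (λ a b → c a · (d b · y (j + a + b))) ⟩
    ∑< C (λ b → ∑< B (λ a → c a · (d b · y (j + a + b))))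
      ≡⟨ ∑<-cong C (λ b _ → ∑<-cong B (λ a _ →
           trans (x∙yz≈y∙xz (c a) (d b) (y (j + a + b))) (cong (λ k → d b · (c a · y k)) (m+n+o≡m+o+n j a b)))) ⟩
    ∑< C (λ b → ∑< B (λ a → d b · (c a · y (j + b + a))))
      ≡⟨ ∑<-cong C (λ b _ → *-distribˡ-∑< B (d b) (λ a → c a · y (j + b + a))) ⟨
    ∑< C (λ b → d b · ∑< B (λ a → c a · y (j + b + a)))
      ∎

  act-zero : ∀ B c y j → (∀ a → a < B → y (j + a) ≡ 0#) → act B c y j ≡ 0#
  act-zero B c y j y≡0 = ∑<-zero B (λ a a<B → trans (cong (c a ·_) (y≡0 a a<B)) (zeroʳ (c a)))

  act-sub : ∀ B c y z j → act B c (λ k → y k ⊕ - z k) j ≡ act B c y j ⊕ - act B c z j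
  act-sub B c y z j = begin
    ∑< B (λ a → c a · (y (j + a) ⊕ - z (j + a)))
      ≡⟨ ∑<-cong B (λ a _ → trans (distribˡ (c a) _ _) (cong (c a · y (j + a) ⊕_) (sym (-‿distribʳ-* (c a) (z (j + a)))))) ⟩
    ∑< B (λ a → c a · y (j + a) ⊕ - (c a · z (j + a)))
      ≡⟨ ∑<-+ B (λ a → c a · y (j + a)) (λ a → - (c a · z (j + a))) ⟩
    act B c y j ⊕ ∑< B (λ a → - (c a · z (j + a)))
      ≡⟨ cong (act B c y j ⊕_) (-‿distrib-∑< B (λ a → c a · z (j + a))) ⟨
    act B c y j ⊕ - act B c z j
      ∎

  record _∈Ann_ (c y : Seq) : Set where
    constructor annihilates
    field
      bound          : ℕ
      bound-zeroFrom : ZeroFrom bound c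
      act≡0          : ∀ i → act bound c y i ≡ 0#

  act-pad : ∀ {B B′ c} y → ZeroFrom B c → B ≤ B′ → ∀ i → act B′ c y i ≡ act B c y i
  act-pad {c = c} y c≡0 B≤B′ i =
    ∑<-pad (λ a → c a · y (i + a)) (λ a B≤a → trans (cong (_· y (i + a)) (c≡0 a B≤a)) (zeroˡ _)) B≤B′

  ∈Ann⇒act≡0 : ∀ {B c y} → c ∈Ann y → ZeroFrom B c → ∀ i → act B c y i ≡ 0#
  ∈Ann⇒act≡0 {B} {c} {y} (annihilates B₀ c≡0₀ act≡0) c≡0 i = begin
    act B c y i         ≡⟨ act-pad y c≡0 (ℕ.m≤m+n B B₀) i ⟨
    act (B + B₀) c y i  ≡⟨ act-pad y c≡0₀ (ℕ.m≤n+m B₀ B) i ⟩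
    act B₀ c y i        ≡⟨ act≡0 i ⟩
    0#                  ∎

  Ann-isIdeal : ∀ y → IsIdeal (_∈Ann y)
  Ann-isIdeal y = record
    { ∈-cong       = λ { s≗t (annihilates B s≡0 act≡0) →
        annihilates B (λ m B≤m → trans (sym (s≗t m)) (s≡0 m B≤m))
        (λ i → trans (∑<-cong B (λ a _ → cong (_· y (i + a)) (sym (s≗t a)))) (act≡0 i)) }
    ; +-closed     = +-closed
    ; scale-closed = scale-closed
    ; shift-closed = λ { {s} (annihilates B s≡0 act≡0) → annihilates (suc B) (zeroFrom-shift s≡0)
        (λ i → trans (cong₂ _⊕_ (zeroˡ (y (i + 0)))
                                (∑<-cong B (λ a _ → cong (λ k → s a · y k) (ℕ.+-suc i a))))
                     (trans (+-identityˡ _) (act≡0 (suc i)))) }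
    }
    where
    +-closed : ∀ {s t} → s ∈Ann y → t ∈Ann y → (λ m → s m ⊕ t m) ∈Ann y
    +-closed {s} {t} s∈@(annihilates B s≡0 _) t∈@(annihilates C t≡0 _) = annihilates (B + C) s+t≡0 λ i → begin
      ∑< (B + C) (λ a → (s a ⊕ t a) · y (i + a))   ≡⟨ ∑<-cong (B + C) (λ a _ → distribʳ (y (i + a)) (s a) (t a)) ⟩
      ∑< (B + C) (λ a → s a · y (i + a) ⊕ t a · y (i + a))
        ≡⟨ ∑<-+ (B + C) (λ a → s a · y (i + a)) (λ a → t a · y (i + a)) ⟩
      act (B + C) s y i ⊕ act (B + C) t y i         ≡⟨ cong₂ _⊕_ (∈Ann⇒act≡0 s∈ s≡0′ i) (∈Ann⇒act≡0 t∈ t≡0′ i) ⟩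
      0# ⊕ 0#                                       ≡⟨ +-identityʳ 0# ⟩
      0#                                            ∎
      where
      s≡0′ = zeroFrom-mono (ℕ.m≤m+n B C) s≡0
      t≡0′ = zeroFrom-mono (ℕ.m≤n+m C B) t≡0
      s+t≡0 : ZeroFrom (B + C) (λ m → s m ⊕ t m)
      s+t≡0 m B+C≤m = trans (cong₂ _⊕_ (s≡0′ m B+C≤m) (t≡0′ m B+C≤m)) (+-identityʳ 0#)

    scale-closed : ∀ {s} c → s ∈Ann y → (λ m → c · s m) ∈Ann y
    scale-closed {s} c (annihilates B s≡0 act≡0) =
      annihilates B (λ m B≤m → trans (cong (c ·_) (s≡0 m B≤m)) (zeroʳ c))
      λ i → trans (∑<-cong B (λ a _ → *-assoc c (s a) (y (i + a))))
              (trans (sym (*-distribˡ-∑< B c (λ a → s a · y (i + a)))) (trans (cong (c ·_) (act≡0 i)) (zeroʳ c)))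

  δ∈Ann⇒≡0 : ∀ {y} → δ ∈Ann y → ∀ i → y i ≡ 0#
  δ∈Ann⇒≡0 {y} δ∈ i = begin
    y i                  ≡⟨ cong y (ℕ.+-identityʳ i) ⟨
    y (i + 0)            ≡⟨ *-identityˡ (y (i + 0)) ⟨
    1# · y (i + 0)       ≡⟨ +-identityʳ (1# · y (i + 0)) ⟨
    act 1 δ y i          ≡⟨ ∈Ann⇒act≡0 {1} δ∈ (λ { (suc m) _ → refl }) i ⟩
    0#                   ∎

  coeff-zeroFrom-length : ∀ p → ZeroFrom (length p) (coeff p)
  coeff-zeroFrom-length []      m       _         = refl
  coeff-zeroFrom-length (x ∷ p) (suc m) (s≤s p≤m) = coeff-zeroFrom-length p m p≤m

  coeff-applyUpTo : ∀ B {s} → ZeroFrom B s → coeff (applyUpTo s B) ≗ s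
  coeff-applyUpTo zero    s≡0 m       = sym (s≡0 m z≤n)
  coeff-applyUpTo (suc B) s≡0 zero    = refl
  coeff-applyUpTo (suc B) s≡0 (suc m) = coeff-applyUpTo B (λ k B≤k → s≡0 (suc k) (s≤s B≤k)) m

  ∣⇒∣ₚ : ∀ {B g} p → ZeroFrom B g → g ∣ coeff p → applyUpTo g B ∣ₚ p
  ∣⇒∣ₚ {B} {g} p g≡0 (divides s C s≡0 g⋆s≗p) =
    applyUpTo s C , λ m → trans (mulCoeff≡⋆ (applyUpTo g B) (applyUpTo s C) m)
      (trans (⋆-cong (coeff-applyUpTo B g≡0) (coeff-applyUpTo C s≡0) m) (g⋆s≗p m))

  ∣ₚ-closed : ∀ {P} → IsIdeal P → ∀ d p → d ∣ₚ p → P (coeff d) → P (coeff p)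
  ∣ₚ-closed ideal d p (s , d·s≡p) Pd =
    ∈-cong (λ m → trans (sym (mulCoeff≡⋆ d s m)) (d·s≡p m)) (⋆-closed Pd (length s) (coeff-zeroFrom-length s))
    where open IsIdeal ideal

  constant⇒unit : ∀ d → coeff d 0 ≢ 0# → ZeroFrom 1 (coeff d) → d ∣ₚ (1# ∷ [])
  constant⇒unit d d₀≢0 d≡0 with inverse (coeff d 0) d₀≢0
  ... | d₀⁻¹ , d₀d₀⁻¹≡1 = d₀⁻¹ ∷ [] , λ m → begin
    mulCoeff d (d₀⁻¹ ∷ []) m                ≡⟨ mulCoeff≡⋆ d (d₀⁻¹ ∷ []) m ⟩
    (coeff d ⋆ coeff (d₀⁻¹ ∷ [])) m         ≡⟨ ⋆-cong {coeff d} (λ _ → refl) d₀⁻¹∷[]≗ m ⟩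
    (coeff d ⋆ (λ k → d₀⁻¹ · δ k)) m        ≡⟨ ⋆-scaleʳ (coeff d) d₀⁻¹ δ m ⟩
    d₀⁻¹ · (coeff d ⋆ δ) m                  ≡⟨ cong (d₀⁻¹ ·_) (⋆-δ (coeff d) m) ⟩
    d₀⁻¹ · coeff d m                        ≡⟨ d₀⁻¹·d≗δ m ⟩
    δ m                                     ∎
    where
    d₀⁻¹∷[]≗ : coeff (d₀⁻¹ ∷ []) ≗ (λ k → d₀⁻¹ · δ k)
    d₀⁻¹∷[]≗ zero    = sym (*-identityʳ d₀⁻¹)
    d₀⁻¹∷[]≗ (suc k) = sym (zeroʳ d₀⁻¹)
    d₀⁻¹·d≗δ : ∀ m → d₀⁻¹ · coeff d m ≡ δ m
    d₀⁻¹·d≗δ zero    = trans (*-comm d₀⁻¹ (coeff d 0)) d₀d₀⁻¹≡1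
    d₀⁻¹·d≗δ (suc m) = trans (cong (d₀⁻¹ ·_) (d≡0 (suc m) (s≤s z≤n))) (zeroʳ d₀⁻¹)

  coprime-∈Ann⇒≡0 : DecidableEquality Carrier → ∀ p r {y} → Coprime p r →
                    coeff p ∈Ann y → coeff r ∈Ann y → ∀ i → y i ≡ 0#
  coprime-∈Ann⇒≡0 _≟_ p r {y} coprime p∈ r∈
    with g , B , g≡0 , g∈ , g∣p , g∣r ←
         euclid _≟_ (Ann-isIdeal y) (length p) (length r) (coeff-zeroFrom-length p) (coeff-zeroFrom-length r) p∈ r∈
    = δ∈Ann⇒≡0 (∣ₚ-closed (Ann-isIdeal y) (applyUpTo g B) (1# ∷ [])
                           (coprime (applyUpTo g B) (∣⇒∣ₚ p g≡0 g∣p) (∣⇒∣ₚ r g≡0 g∣r))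
                 (∈-cong (λ m → sym (coeff-applyUpTo B g≡0 m)) g∈))
    where open IsIdeal (Ann-isIdeal y)

  -- The recurrence c₀ y_j + … + c_e y_{j+e} = 0 with c_e ≠ 0.
  module Recurrence (c : Seq) (e′ : ℕ) (c-top≢0 : c (suc e′) ≢ 0#) where

    e : ℕ
    e = suc e′

    SatisfiedAt : Seq → ℕ → Set
    SatisfiedAt u j = act (suc e) c u j ≡ 0#

    c-top⁻¹ : Carrier
    c-top⁻¹ = proj₁ (inverse (c e) c-top≢0)

    next : Seq → Carrier
    next w = - (c-top⁻¹ · ∑< e (λ a → c a · w a))

    -- a window holds e consecutive terms y_j, …, y_{j+e-1}
    slide : Seq → Seq
    slide w a with a <? e′
    ... | yes _ = w (suc a)
    ... | no  _ = next w

    slide-< : ∀ w {a} → a < e′ → slide w a ≡ w (suc a)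
    slide-< w {a} a<e′ with a <? e′
    ... | yes _    = refl
    ... | no  a≮e′ = ⊥-elim (a≮e′ a<e′)

    slide-last : ∀ w → slide w e′ ≡ next w
    slide-last w with e′ <? e′
    ... | yes e′<e′ = ⊥-elim (ℕ.<-irrefl refl e′<e′)
    ... | no  _     = refl

    window : Seq → ℕ → Seq
    window init zero    = init
    window init (suc j) = slide (window init j)

    solution : Seq → Seq
    solution init j = window init j 0

    solution-+ : ∀ init a j → a < e → solution init (j + a) ≡ window init j a
    solution-+ init zero    j _     = cong (solution init) (ℕ.+-identityʳ j)
    solution-+ init (suc a) j 1+a<e = begin
      solution init (j + suc a)  ≡⟨ cong (solution init) (ℕ.+-suc j a) ⟩
      solution init (suc j + a)  ≡⟨ solution-+ init a (suc j) (ℕ.<⇒≤ 1+a<e) ⟩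
      slide (window init j) a    ≡⟨ slide-< (window init j) (ℕ.≤-pred 1+a<e) ⟩
      window init j (suc a)      ∎

    solution-init : ∀ init a → a < e → solution init a ≡ init a
    solution-init init a = solution-+ init a 0

    solution-next : ∀ init j → solution init (j + e) ≡ next (window init j)
    solution-next init j = begin
      solution init (j + e)        ≡⟨ cong (solution init) (ℕ.+-suc j e′) ⟩
      solution init (suc j + e′)   ≡⟨ solution-+ init e′ (suc j) (ℕ.n<1+n e′) ⟩
      slide (window init j) e′     ≡⟨ slide-last (window init j) ⟩
      next (window init j)         ∎

    solution-satisfied : ∀ init j → SatisfiedAt (solution init) j
    solution-satisfied init j = begin
      act (suc e) c (solution init) j
        ≡⟨ ∑<-last e (λ a → c a · solution init (j + a)) ⟩
      ∑< e (λ a → c a · solution init (j + a)) ⊕ c e · solution init (j + e)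
        ≡⟨ cong₂ _⊕_ (∑<-cong e (λ a a<e → cong (c a ·_) (solution-+ init a j a<e)))
                     (cong (c e ·_) (solution-next init j)) ⟩
      S ⊕ c e · - (c-top⁻¹ · S)
        ≡⟨ cong (S ⊕_) (sym (-‿distribʳ-* (c e) (c-top⁻¹ · S))) ⟩
      S ⊕ - (c e · (c-top⁻¹ · S))
        ≡⟨ cong (λ t → S ⊕ - t) (*-cancel-inverse (proj₂ (inverse (c e) c-top≢0)) S) ⟩
      S ⊕ - S
        ≡⟨ -‿inverseʳ S ⟩
      0# ∎
      where S = ∑< e (λ a → c a · window init j a)

    ∈Ann-solution : ZeroFrom (suc e) c → ∀ init → c ∈Ann solution init
    ∈Ann-solution c≡0 init = annihilates (suc e) c≡0 (solution-satisfied init)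

    leading-term : ∀ u j → SatisfiedAt u j → c e · u (j + e) ≡ - ∑< e (λ a → c a · u (j + a))
    leading-term u j sat =
      inverseʳ-unique _ _ (trans (sym (∑<-last e (λ a → c a · u (j + a)))) sat)

    solutions-unique : ∀ M {u v} → (∀ j → j < M → SatisfiedAt u j) → (∀ j → j < M → SatisfiedAt v j) →
                       (∀ a → a < e → u a ≡ v a) → ∀ i → i < M + e → u i ≡ v i
    solutions-unique zero    _     _     u≡v = u≡v
    solutions-unique (suc M) {u} {v} u-sat v-sat u≡v i i<1+M+e with ℕ.m<1+n⇒m<n∨m≡n i<1+M+e
    ... | inj₁ i<M+e = solutions-unique M (λ j j<M → u-sat j (ℕ.m<n⇒m<1+n j<M))
                                          (λ j j<M → v-sat j (ℕ.m<n⇒m<1+n j<M)) u≡v i i<M+e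
    ... | inj₂ refl  = *-cancelˡ-≢0 c-top≢0 (begin
      c e · u (M + e)                     ≡⟨ leading-term u M (u-sat M ℕ.≤-refl) ⟩
      - ∑< e (λ a → c a · u (M + a))      ≡⟨ cong -_ (∑<-cong e (λ a a<e → cong (c a ·_) (earlier a a<e))) ⟩
      - ∑< e (λ a → c a · v (M + a))      ≡⟨ leading-term v M (v-sat M ℕ.≤-refl) ⟨
      c e · v (M + e)                     ∎)
      where
      earlier : ∀ a → a < e → u (M + a) ≡ v (M + a)
      earlier a a<e = solutions-unique M (λ j j<M → u-sat j (ℕ.m<n⇒m<1+n j<M))
                        (λ j j<M → v-sat j (ℕ.m<n⇒m<1+n j<M)) u≡v (M + a) (ℕ.+-monoʳ-< M a<e)

  -- x, read as a vector of K^{2n}, lies in the kernel of the automaton with rule p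
  InKernel : ℕ → Pol → Seq → Set
  InKernel n p x = ∀ j → j < n → act (suc n) (coeff p) x j ≡ 0#

  window-index< : ∀ {n j a} → j < n → a < suc n → j + a < n + n
  window-index< j<n a<1+n = ℕ.+-mono-<-≤ j<n (ℕ.≤-pred a<1+n)

  -- x extends to the solution y of the recurrence of p; the r-transform of y solves the same
  -- recurrence and vanishes on [0, n), hence everywhere, so both p and r annihilate y.
  coprime⇒kernels-disjoint : DecidableEquality Carrier → ∀ n′ p r → let n = suc n′ in
    ZeroFrom (suc n) (coeff p) → coeff p n ≢ 0# → ZeroFrom (suc n) (coeff r) → Coprime p r →
    ∀ x → InKernel n p x → InKernel n r x → ∀ i → i < n + n → x i ≡ 0#
  coprime⇒kernels-disjoint _≟_ n′ p r p≡0 p-top≢0 r≡0 coprime x p-kills r-kills i i<2n =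
    trans (x≡y i i<2n) (y≡0 i)
    where
    open Recurrence (coeff p) n′ p-top≢0
    y : Seq
    y = solution x
    x≡y : ∀ i → i < e + e → x i ≡ y i
    x≡y = solutions-unique e p-kills (λ j _ → solution-satisfied x j) (λ a a<e → sym (solution-init x a a<e))
    w : Seq
    w = act (suc e) (coeff r) y
    w-satisfied : ∀ j → SatisfiedAt w j
    w-satisfied j = trans (act-comm (suc e) (suc e) (coeff p) (coeff r) y j)
      (act-zero (suc e) (coeff r) (act (suc e) (coeff p) y) j (λ b _ → solution-satisfied x (j + b)))
    w≡0 : ∀ i → w i ≡ 0#
    w≡0 i = solutions-unique (suc i) (λ j _ → w-satisfied j)
      (λ j _ → act-zero (suc e) (coeff p) (λ _ → 0#) j (λ _ _ → refl)) w≡x-transform i (s≤s (ℕ.m≤m+n i e))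
      where
      w≡x-transform : ∀ j → j < e → w j ≡ 0#
      w≡x-transform j j<e = trans
        (∑<-cong (suc e) (λ b b<1+e → cong (coeff r b ·_) (sym (x≡y (j + b) (window-index< j<e b<1+e)))))
        (r-kills j j<e)
    y≡0 : ∀ i → y i ≡ 0#
    y≡0 = coprime-∈Ann⇒≡0 _≟_ p r coprime (∈Ann-solution p≡0 x) (annihilates (suc e) r≡0 w≡0)

  nonconstant⇒∈Ann-nonzero : ∀ d e′ → ZeroFrom (suc (suc e′)) d → d (suc e′) ≢ 0# →
                             Σ[ y ∈ Seq ] y 0 ≡ 1# × d ∈Ann y
  nonconstant⇒∈Ann-nonzero d e′ d≡0 d-top≢0 = solution δ , solution-init δ 0 (s≤s z≤n) , ∈Ann-solution d≡0 δ
    where open Recurrence d e′ d-top≢0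

  toSeq : ∀ {m} → Vec Carrier m → Seq
  toSeq u = coeff (Vec.toList u)

  toSeq-toℕ : ∀ {m} (u : Vec Carrier m) i → toSeq u (Fin.toℕ i) ≡ lookup u i
  toSeq-toℕ (x ∷ u) zero        = refl
  toSeq-toℕ (x ∷ u) (Fin.suc i) = toSeq-toℕ u i

  toSeq-injective : ∀ {m} (u v : Vec Carrier m) → (∀ k → k < m → toSeq u k ≡ toSeq v k) → u ≡ v
  toSeq-injective u v u≡v = lookup-ext u v (λ i →
    trans (sym (toSeq-toℕ u i)) (trans (u≡v (Fin.toℕ i) (Fin.toℕ<n i)) (toSeq-toℕ v i)))

  toSeq-tabulate : ∀ {m} (y : Seq) k → k < m → toSeq (tabulate {n = m} (λ i → y (Fin.toℕ i))) k ≡ y k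
  toSeq-tabulate {m} y k k<m = begin
    toSeq t k                             ≡⟨ cong (toSeq t) (Fin.toℕ-fromℕ< k<m) ⟨
    toSeq t (Fin.toℕ (Fin.fromℕ< k<m))    ≡⟨ toSeq-toℕ t (Fin.fromℕ< k<m) ⟩
    lookup t (Fin.fromℕ< k<m)             ≡⟨ Vec.lookup∘tabulate (λ i → y (Fin.toℕ i)) (Fin.fromℕ< k<m) ⟩
    y (Fin.toℕ (Fin.fromℕ< k<m))          ≡⟨ cong y (Fin.toℕ-fromℕ< k<m) ⟩
    y k                                   ∎
    where t = tabulate {n = m} (λ i → y (Fin.toℕ i))

  toSeq-replicate : ∀ m k → toSeq (replicate m 0#) k ≡ 0#
  toSeq-replicate zero    k       = refl
  toSeq-replicate (suc m) zero    = refl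
  toSeq-replicate (suc m) (suc k) = toSeq-replicate m k

  open Linear K using (linearRule; polyOf)

  coeff-polyOf : ∀ {d} (a : Fin d → Carrier) i → coeff (polyOf a) (Fin.toℕ i) ≡ a i
  coeff-polyOf a i = trans (toSeq-toℕ (tabulate a) i) (Vec.lookup∘tabulate a i)

  polyOf-zeroFrom : ∀ {d} (a : Fin d → Carrier) → ZeroFrom d (coeff (polyOf a))
  polyOf-zeroFrom {d} a = subst (λ B → ZeroFrom B (coeff (polyOf a))) (Vec.length-toList (tabulate a))
                                (coeff-zeroFrom-length (polyOf a))

  LinearCA : ∀ n → (Fin (suc n) → Carrier) → Vec Carrier (n + n) → Vec Carrier n
  LinearCA n a = CA.NBCA n n (linearRule a)

  lookup-LinearCA : ∀ n a u i → lookup (LinearCA n a u) i ≡ act (suc n) (coeff (polyOf a)) (toSeq u) (Fin.toℕ i)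
  lookup-LinearCA n a u i =
    trans (Vec.lookup∘tabulate _ i)
          (sum-cong-≗ {suc n} (λ j → cong₂ _·_ (sym (coeff-polyOf a j)) (window-entry j)))
    where
    window-entry : ∀ j → lookup u (Fin.fromℕ< (ℕ.+-mono-<-≤ (Fin.toℕ<n i) (Fin.toℕ≤pred[n] j))) ≡
                         toSeq u (Fin.toℕ i + Fin.toℕ j)
    window-entry j = let i+j<2n = ℕ.+-mono-<-≤ (Fin.toℕ<n i) (Fin.toℕ≤pred[n] j) in
      trans (sym (toSeq-toℕ u (Fin.fromℕ< i+j<2n))) (cong (toSeq u) (Fin.toℕ-fromℕ< i+j<2n))

  LinearCA-≡⇒InKernel : ∀ n a u v → LinearCA n a u ≡ LinearCA n a v →
                         InKernel n (polyOf a) (λ k → toSeq u k ⊕ - toSeq v k)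
  LinearCA-≡⇒InKernel n a u v Fu≡Fv j j<n = begin
    act (suc n) A (λ k → toSeq u k ⊕ - toSeq v k) j   ≡⟨ act-sub (suc n) A (toSeq u) (toSeq v) j ⟩
    act (suc n) A (toSeq u) j ⊕ - act (suc n) A (toSeq v) j
      ≡⟨ cong (λ t → t ⊕ - act (suc n) A (toSeq v) j)
              (trans (cell u) (trans (cong (λ w → lookup w (Fin.fromℕ< j<n)) Fu≡Fv) (sym (cell v)))) ⟩
    act (suc n) A (toSeq v) j ⊕ - act (suc n) A (toSeq v) j   ≡⟨ -‿inverseʳ _ ⟩
    0#                                                        ∎
    where
    A = coeff (polyOf a)
    cell : ∀ w → act (suc n) A (toSeq w) j ≡ lookup (LinearCA n a w) (Fin.fromℕ< j<n)
    cell w = trans (cong (act (suc n) A (toSeq w)) (sym (Fin.toℕ-fromℕ< j<n)))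
                   (sym (lookup-LinearCA n a w (Fin.fromℕ< j<n)))

  ∈Ann⇒LinearCA-prefix≡0 : ∀ n a {y} → coeff (polyOf a) ∈Ann y →
    LinearCA n a (tabulate (λ i → y (Fin.toℕ i))) ≡ LinearCA n a (replicate (n + n) 0#)
  ∈Ann⇒LinearCA-prefix≡0 n a {y} a∈ = lookup-ext _ _ λ i → begin
    lookup (LinearCA n a prefix) i
      ≡⟨ lookup-LinearCA n a prefix i ⟩
    act (suc n) A (toSeq prefix) (Fin.toℕ i)
      ≡⟨ ∑<-cong (suc n) (λ b b<1+n → cong (A b ·_)
           (toSeq-tabulate y (Fin.toℕ i + b) (window-index< (Fin.toℕ<n i) b<1+n))) ⟩
    act (suc n) A y (Fin.toℕ i)
      ≡⟨ ∈Ann⇒act≡0 a∈ (polyOf-zeroFrom a) (Fin.toℕ i) ⟩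
    0#
      ≡⟨ act-zero (suc n) A (toSeq zeros) (Fin.toℕ i) (λ b _ → toSeq-replicate (n + n) _) ⟨
    act (suc n) A (toSeq zeros) (Fin.toℕ i)
      ≡⟨ lookup-LinearCA n a zeros i ⟨
    lookup (LinearCA n a zeros) i
      ∎
    where
    A = coeff (polyOf a)
    prefix = tabulate {n = n + n} (λ i → y (Fin.toℕ i))
    zeros = replicate (n + n) 0#

  coprime⇒jointlyInjective : DecidableEquality Carrier → ∀ n′ (a b : Fin (suc (suc n′)) → Carrier) →
    a (fromℕ (suc n′)) ≢ 0# → Coprime (polyOf a) (polyOf b) → JointlyInjective (LinearCA (suc n′) a) (LinearCA (suc n′) b)
  coprime⇒jointlyInjective _≟_ n′ a b a-top≢0 coprime u v Fu≡Fv Gu≡Gv =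
    toSeq-injective u v λ k k<2n → x∙y⁻¹≈ε⇒x≈y _ _
      (coprime⇒kernels-disjoint _≟_ n′ (polyOf a) (polyOf b) (polyOf-zeroFrom a) top≢0 (polyOf-zeroFrom b)
         coprime (λ k → toSeq u k ⊕ - toSeq v k)
         (LinearCA-≡⇒InKernel _ a u v Fu≡Fv) (LinearCA-≡⇒InKernel _ b u v Gu≡Gv) k k<2n)
    where
    top≢0 : coeff (polyOf a) (suc n′) ≢ 0#
    top≢0 = subst (λ k → coeff (polyOf a) k ≢ 0#) (Fin.toℕ-fromℕ (suc n′))
                  (λ eq → a-top≢0 (trans (sym (coeff-polyOf a (fromℕ (suc n′)))) eq))

  jointlyInjective⇒coprime : DecidableEquality Carrier → ∀ n′ (a b : Fin (suc (suc n′)) → Carrier) →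
    a zero ≢ 0# → JointlyInjective (LinearCA (suc n′) a) (LinearCA (suc n′) b) → Coprime (polyOf a) (polyOf b)
  jointlyInjective⇒coprime _≟_ n′ a b a₀≢0 injective d d∣a@(s , d·s≡a) d∣b
    with degree? _≟_ (length d) (coeff-zeroFrom-length d)
  ... | inj₁ d≡0 = ⊥-elim (a₀≢0 (begin
    a zero                    ≡⟨ d·s≡a 0 ⟨
    coeff d 0 · coeff s 0     ≡⟨ cong (_· coeff s 0) (d≡0 0) ⟩
    0# · coeff s 0            ≡⟨ zeroˡ (coeff s 0) ⟩
    0#                        ∎))
  ... | inj₂ (zero , d₀≢0 , d≡0) = constant⇒unit d d₀≢0 d≡0
  ... | inj₂ (suc e′ , d-top≢0 , d≡0)
    with y , y₀≡1 , d∈ ← nonconstant⇒∈Ann-nonzero (coeff d) e′ d≡0 d-top≢0 =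
    ⊥-elim (0≢1 (begin
      0#                                   ≡⟨ toSeq-replicate (n + n) 0 ⟨
      toSeq (replicate (n + n) 0#) 0       ≡⟨ cong (λ w → toSeq w 0) prefix≡0 ⟨
      toSeq prefix 0                       ≡⟨ toSeq-tabulate {n + n} y 0 (s≤s z≤n) ⟩
      y 0                                  ≡⟨ y₀≡1 ⟩
      1#                                   ∎))
    where
    n = suc n′
    prefix = tabulate {n = n + n} (λ i → y (Fin.toℕ i))
    prefix≡0 : prefix ≡ replicate (n + n) 0#
    prefix≡0 = injective prefix (replicate (n + n) 0#)
      (∈Ann⇒LinearCA-prefix≡0 n a (∣ₚ-closed (Ann-isIdeal y) d (polyOf a) d∣a d∈))
      (∈Ann⇒LinearCA-prefix≡0 n b (∣ₚ-closed (Ann-isIdeal y) d (polyOf b) d∣b d∈))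

-- The order q of K enters only through the decidability of equality on K.
corollary1 : (q n k : ℕ) → IsPrimePower q → 1 ≤ n →
  (K : Field) → HasOrder K q →
  (φ : Vec (Field.Carrier K) n ↔ Fin (q ^ n)) →
  (a : Fin k → Fin (suc n) → Field.Carrier K) →
  (∀ i → a i zero ≢ Field.0# K) →
  (∀ i → a i (fromℕ n) ≢ Field.0# K) →
  MutuallyOrthogonal
    (λ i → LatinSquareOf φ (CA.NBCA n n (Linear.linearRule K (a i))))
  ⇔ (∀ i j → i ≢ j → Poly.Coprime K (Linear.polyOf K (a i)) (Linear.polyOf K (a j)))
corollary1 q (suc n′) k _ _ K order φ a a₀≢0 aₙ≢0 = mk⇔
  (λ orthogonal i j i≢j → jointlyInjective⇒coprime K _≟_ n′ (a i) (a j) (a₀≢0 i)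
                            (orthogonal⇒jointlyInjective φ _ _ (orthogonal i j i≢j)))
  (λ coprime i j i≢j → jointlyInjective⇒orthogonal φ _ _
                         (coprime⇒jointlyInjective K _≟_ n′ (a i) (a j) (aₙ≢0 i) (coprime i j i≢j)))
  where
  _≟_ : DecidableEquality (Field.Carrier K)
  _≟_ = Fin.inj⇒≟ (Bijection.injection order)
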